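{- Let $\mathcal A,\mathcal B$ be countably infinite structures, let $\mathcal B$ be a fixed presentation with domain $\omega$, let $(\Phi,\Phi_*)$ witness a computable functor $F:\mathrm{Iso}(\mathcal B)\to\mathrm{Iso}(\mathcal A)$, and let $\mathrm{Dom}^{\mathcal B}_{\mathcal A}$, $\sim$, and $R_k$ be as defined below. Define $\mathfrak F:\omega\to\mathrm{Dom}^{\mathcal B}_{\mathcal A}$ by $\mathfrak F(i)=(\mathcal B\upharpoonright n,i)$ for the least $n$ such that $(\mathcal B\upharpoonright n,i)\in\mathrm{Dom}^{\mathcal B}_{\mathcal A}$, where $\mathcal B\upharpoonright n$ denotes the tuple $(0,1,\dots,n-1)$ of elements of $\mathcal B$. Then $\mathfrak F$ induces an isomorphism of $F(\mathcal B)$ (the structure on $\omega$ with atomic diagram $\Phi^{D(\mathcal B)}$) onto $(\mathrm{Dom}^{\mathcal B}_{\mathcal A}/\sim;R_0/\sim,R_1/\sim,\dots)$, where $R_k/\sim$ interprets the $k$-th relation symbol $P_k$ of $\mathcal A$.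
   Context: $\mathrm{Iso}(\mathcal A)$ is the category of copies of $\mathcal A$ with domain $\omega$ and all isomorphisms; $D(\mathcal M)$ is the atomic diagram. A computable functor $F:\mathrm{Iso}(\mathcal B)\to\mathrm{Iso}(\mathcal A)$ is given by computable operators $\Phi,\Phi_*$ with $\Phi^{D(\hat{\mathcal B})}=D(F(\hat{\mathcal B}))$ and $\Phi_*^{D(\hat{\mathcal B})\oplus f\oplus D(\tilde{\mathcal B})}=F(f)$ for isomorphisms $f:\hat{\mathcal B}\to\tilde{\mathcal B}$ (functions identified with graphs). The language of $\mathcal A$ is relational with symbols $P_k$ of computable arity $p(k)$. Notation: $\lambda$ is the identity on $\omega$. For a tuple $\bar b$ of length $n$, $D(\bar b)$ is the finite binary string coding (fixed Gödel numbering) the atomic facts about $(0,\dots,n-1)$ in the pullback $\mathcal B_f$ (for any bijection $f:\omega\to\mathcal B$ extending $k\mapsto b_k$) mentioning only the first $n$ relation symbols; it is an initial segment of $D(\mathcal B_f)$. For a permutation $\sigma$ of $\{0,\dots,m-1\}$, $(\bar x)_\sigma=(x_{\sigma(0)},\dots,x_{\sigma(m-1)})$. A finite-oracle computation converges if it halts without querying beyond the oracle. $\mathrm{Dom}^{\mathcal B}_{\mathcal A}$ is the set of $(\bar b,i)\in\mathcal B^{<\omega}\times\omega$ with $\Phi_*^{D(\bar b)\oplus\lambda\upharpoonright|\bar b|\oplus D(\bar b)}(i)\downarrow=i$. For $(\bar b,i),(\bar c,j)\in\mathrm{Dom}^{\mathcal B}_{\mathcal A}$: $(\bar b,i)\sim(\bar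 c,j)$ iff there is a finite tuple $\bar d$ not mentioning elements of $\bar b,\bar c$ such that, letting $\bar c'$ list $\bar c\setminus\bar b$, $\bar b'$ list $\bar b\setminus\bar c$, and $\sigma$ be the finite permutation with $(\bar b\bar c'\bar d)=(\bar c\bar b'\bar d)_\sigma$, we have $\Phi_*^{D(\bar b\bar c'\bar d)\oplus\sigma\oplus D(\bar c\bar b'\bar d)}(i)\downarrow=j$ and $\Phi_*^{D(\bar c\bar b'\bar d)\oplus\sigma^{ -1}\oplus D(\bar b\bar c'\bar d)}(j)\downarrow=i$. (This $\sim$ is an equivalence relation on $\mathrm{Dom}^{\mathcal B}_{\mathcal A}$.) For each $k$ with $p=p(k)$, $R_k$ holds of $(\bar b_1,i_1),\dots,(\bar b_p,i_p)\in\mathrm{Dom}^{\mathcal B}_{\mathcal A}$ iff there are a tuple $\bar c$ and $j_1,\dots,j_p\in\omega$ with $(\bar b_s,i_s)\sim(\bar c,j_s)$ for each $s$ and the atomic formula $P_k(j_1,\dots,j_p)$ true according to the finite partial diagram $\Phi^{D(\bar c)}$. -}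

module Defs where

open import Data.Nat using (ℕ; zero; suc; _<ᵇ_; _≡ᵇ_; _<_)
open import Data.Nat.Properties using (_≟_)
open import Data.Bool using (Bool; true; false; if_then_else_; _∧_)
open import Data.Maybe using (Maybe; just; nothing)
open import Data.Product using (Σ; ∃; ∃-syntax; _×_; _,_)
open import Data.Sum using (_⊎_; inj₁; inj₂)
open import Data.List using (List; []; _∷_; length; upTo; filter; _++_)
import Data.List.Relation.Unary.All as LAll
open import Data.List.Relation.Unary.Unique.Propositional using (Unique)
open import Data.List.Membership.Propositional using (_∉_)
open import Data.List.Membership.DecPropositional _≟_ using (_∈?_)
open import Data.Vec using (Vec; map; lookup)
import Data.Vec as V
open import Data.Fin using (Fin)
open import Relation.Nullary using (¬?)
open import Relation.Binary.PropositionalEquality using (_≡_)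

-- A relational language is given by the arity function of its symbols P_0, P_1, ...
Arity : Set
Arity = ℕ → ℕ

Str : Arity → Set
Str ar = (k : ℕ) → Vec ℕ (ar k) → Bool

-- Atomic facts P_k(x_1,...,x_{ar k}) (the queries/entries of an atomic diagram).
Atom : Arity → Set
Atom ar = Σ ℕ (λ k → Vec ℕ (ar k))

D : ∀ {ar} → Str ar → Atom ar → Bool
D M (k , v) = M k v

record Iso {ar : Arity} (M N : Str ar) : Set where
  field
    fun     : ℕ → ℕ
    inv     : ℕ → ℕ
    inv-fun : ∀ x → inv (fun x) ≡ x
    fun-inv : ∀ y → fun (inv y) ≡ y
    pres    : ∀ k (v : Vec ℕ (ar k)) → M k v ≡ N k (map fun v)

data Step (Q O S : Set) : Set where
  halt  : O → Step Q O S
  query : Q → (Bool → S) → Step Q O S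
  tau   : S → Step Q O S

record Machine (Q I O : Set) : Set₁ where
  field
    State : Set
    init  : I → State
    step  : State → Step Q O State

-- Partial oracles: a total oracle X is  just ∘ X ; a finite oracle is
-- defined on finitely many queries.
Oracle : Set → Set
Oracle Q = Q → Maybe Bool

total : ∀ {Q} → (Q → Bool) → Oracle Q
total X q = just (X q)

-- Run from a state halting with output o, never querying outside the
-- domain of the (partial) oracle.
data Runs {Q I O : Set} (Ψ : Machine Q I O) (τ : Oracle Q) :
          Machine.State Ψ → O → Set where
  r-halt  : ∀ {s o} → Machine.step Ψ s ≡ halt o → Runs Ψ τ s o
  r-query : ∀ {s o q k b} → Machine.step Ψ s ≡ query q k → τ q ≡ just b →
            Runs Ψ τ (k b) o → Runs Ψ τ s o
  r-tau   : ∀ {s s' o} → Machine.step Ψ s ≡ tau s' → Runs Ψ τ s' o →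
            Runs Ψ τ s o

Conv : ∀ {Q I O} → Machine Q I O → Oracle Q → I → O → Set
Conv Ψ τ i o = Runs Ψ τ (Machine.init Ψ i) o

join3 : ∀ {Q R} → Oracle Q → Oracle R → Oracle Q → Oracle (Q ⊎ R ⊎ Q)
join3 τ₁ τ₂ τ₃ (inj₁ q)        = τ₁ q
join3 τ₁ τ₂ τ₃ (inj₂ (inj₁ r)) = τ₂ r
join3 τ₁ τ₂ τ₃ (inj₂ (inj₂ q)) = τ₃ q

-- Graph of a total function as an oracle: query (x , y) asks "f(x) = y?".
graph : (ℕ → ℕ) → Oracle (Σ ℕ (λ _ → ℕ))
graph f (x , y) = just (f x ≡ᵇ y)

-- n-th element of a list (default 0, only used in range).
nth : List ℕ → ℕ → ℕ
nth []       _       = 0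
nth (x ∷ xs) zero    = x
nth (x ∷ xs) (suc n) = nth xs n

-- Finite function on {0,...,length s - 1}, x ↦ nth s x, as a finite graph oracle.
finGraph : List ℕ → Oracle (Σ ℕ (λ _ → ℕ))
finGraph s (x , y) = if x <ᵇ length s then just (nth s x ≡ᵇ y) else nothing

indexOf : List ℕ → ℕ → ℕ
indexOf []       x = 0
indexOf (y ∷ ys) x = if x ≡ᵇ y then 0 else suc (indexOf ys x)

-- the permutation σ with  L₁ = (L₂)_σ , i.e. L₁[i] = L₂[σ(i)], as a list.
perm : List ℕ → List ℕ → List ℕ
perm L₁ L₂ = Data.List.map (indexOf L₂) L₁

allᵇ : ∀ {n} → (ℕ → Bool) → Vec ℕ n → Bool
allᵇ p V.[]       = true
allᵇ p (x V.∷ xs) = p x ∧ allᵇ p xs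

-- oracle type of Φ*: D(B̂) ⊕ graph ⊕ D(B̃)
QB : Arity → Set
QB arB = Atom arB ⊎ Σ ℕ (λ _ → ℕ) ⊎ Atom arB

module _ {arA arB : Arity} where

  morOracle : (B̂ B̃ : Str arB) → (ℕ → ℕ) → Oracle (QB arB)
  morOracle B̂ B̃ f = join3 (total (D B̂)) (graph f) (total (D B̃))

  record IsComputableFunctor (A : Str arA) (B : Str arB)
         (Φ : Machine (Atom arB) (Atom arA) Bool)
         (Φ* : Machine (QB arB) ℕ ℕ) : Set₁ where
    field
      -- Φ^{D(B̂)} = D(F(B̂)) with F(B̂) a copy of A
      obj : (B̂ : Str arB) → Iso B̂ B →
            Σ (Str arA) λ M → Iso M A × (∀ a → Conv Φ (total (D B̂)) a (D M a))
      -- Φ*^{D(B̂) ⊕ f ⊕ D(B̃)} = F(f), an isomorphism F(B̂) → F(B̃)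
      mor : (B̂ B̃ : Str arB) (p : Iso B̂ B) (q : Iso B̃ B) (f : Iso B̂ B̃) →
            let M̂ = Data.Product.proj₁ (obj B̂ p)
                M̃ = Data.Product.proj₁ (obj B̃ q)
            in Σ (Iso M̂ M̃) λ g →
                 ∀ i → Conv Φ* (morOracle B̂ B̃ (Iso.fun f)) i (Iso.fun g i)
      -- F(id) = id
      id-law : (B̂ : Str arB) → Iso B̂ B → ∀ i →
               Conv Φ* (morOracle B̂ B̂ (λ x → x)) i i
      -- F(g ∘ f) = F(g) ∘ F(f)
      comp-law : (B̂ B̃ B̌ : Str arB) → Iso B̂ B → Iso B̃ B → Iso B̌ B →
                 (f : Iso B̂ B̃) (g : Iso B̃ B̌) → ∀ i j k →
                 Conv Φ* (morOracle B̂ B̃ (Iso.fun f)) i j →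
                 Conv Φ* (morOracle B̃ B̌ (Iso.fun g)) j k →
                 Conv Φ* (morOracle B̂ B̌ (λ x → Iso.fun g (Iso.fun f x))) i k

  module DomConstruction (B : Str arB)
         (Φ : Machine (Atom arB) (Atom arA) Bool) (Φ* : Machine (QB arB) ℕ ℕ) where

    -- D(b̄): the finite partial diagram of (0,...,n-1) in the pullback of B
    -- along k ↦ b_k, mentioning only the first n relation symbols.
    Dfin : List ℕ → Oracle (Atom arB)
    Dfin b (k , v) =
      let n = length b in
      if (k <ᵇ n) ∧ allᵇ (λ x → x <ᵇ n) v
        then just (B k (map (nth b) v))
        else nothing

    finOracle : List ℕ → List ℕ → List ℕ → Oracle (QB arB)
    finOracle b s c = join3 (Dfin b) (finGraph s) (Dfin c)

    InDom : List ℕ × ℕ → Set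
    InDom (b , i) = Unique b × Conv Φ* (finOracle b (upTo (length b)) b) i i

    minus : List ℕ → List ℕ → List ℕ
    minus c b = filter (λ x → ¬? (x ∈? b)) c

    _∼_ : List ℕ × ℕ → List ℕ × ℕ → Set
    (b , i) ∼ (c , j) =
      InDom (b , i) × InDom (c , j) ×
      ∃[ d ] (Unique d × LAll.All (λ x → x ∉ b ++ c) d ×
        (let X = b ++ minus c b ++ d
             Y = c ++ minus b c ++ d
         in Conv Φ* (finOracle X (perm X Y) Y) i j ×
            Conv Φ* (finOracle Y (perm Y X) X) j i))

    R : (k : ℕ) → Vec (List ℕ × ℕ) (arA k) → Set
    R k args = ∃[ c ] Σ (Vec ℕ (arA k)) λ js →
      Unique c × (∀ (s : Fin (arA k)) → lookup args s ∼ (c , lookup js s)) ×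
      Conv Φ (Dfin c) (k , js) true

    IsLeast : ℕ → ℕ → Set
    IsLeast i n = InDom (upTo n , i) × (∀ m → m < n → ¬ InDom (upTo m , i))
      where open import Relation.Nullary using (¬_)

-- For a bijection f : ℕ → ℕ let B_f be the pullback of B along f.  The functor
-- gives isomorphisms F(g⁻¹ ∘ f) : F(B_f) ≅ F(B_g); "Transport f g i j" says that
-- it sends i to j.  The functor laws make Transport a groupoid action
-- (identity, composition, determinism, totality, symmetry).  Since Φ and Φ* are
-- oracle machines, a convergent computation only consults finitely many oracle
-- values (use principle), so Transport f g i j holds iff every long enough
-- finite approximation D(X̄) ⊕ s ⊕ D(Ȳ) of the oracle computes i ↦ j.  Hence,
-- for enumerations f of b̄ and g of c̄,  (b̄ , i) ∼ (c̄ , j)  iff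
-- Transport f g i j  (∼→transport, transport→∼); the padding tuple d̄ in the
-- definition of ∼ is exactly what makes the approximations long enough.
-- As B↾n is enumerated by the identity, 𝔉 is then injective and onto Dom/∼,
-- and R_k corresponds to D(F(B)) because transports preserve diagrams.
module Submission where

open import Defs
open import Data.Nat using (ℕ; zero; suc; _+_; _∸_; _<_; _≤_; _⊔_; _<ᵇ_; _≡ᵇ_; _<?_; z≤n; s≤s)
open import Data.Nat.Properties
open import Data.Bool using (Bool; true; false; if_then_else_; T)
open import Data.Bool.Properties using (T-≡; T-∧)
open import Data.Maybe using (just; nothing)
open import Data.Product using (Σ; ∃-syntax; _×_; _,_; proj₁; proj₂)
open import Data.Sum using (_⊎_; inj₁; inj₂; [_,_]′; swap)
open import Data.Empty using (⊥; ⊥-elim)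
open import Data.List using (List; []; _∷_; length; upTo; applyUpTo; filter; _++_)
import Data.List as L
import Data.List.Properties as LP
open import Data.List.Relation.Unary.Any using (here; there)
import Data.List.Relation.Unary.All as LAll
open import Data.List.Membership.Propositional using (_∈_; _∉_)
open import Data.List.Membership.Propositional.Properties
  using (∈-filter⁻; ∈-filter⁺; ∈-++⁻; ∈-++⁺ˡ; ∈-++⁺ʳ; ∈-applyUpTo⁻; ∈-upTo⁺)
open import Data.List.Membership.Propositional.Properties.WithK using (unique∧set⇒bag)
open import Data.List.Membership.DecPropositional _≟_ using (_∈?_)
open import Data.List.Relation.Binary.BagAndSetEquality using (∼bag⇒↭)
open import Data.List.Relation.Binary.Permutation.Propositional.Properties using (↭-length)
open import Data.List.Relation.Unary.Unique.Propositional using (Unique)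
open import Data.List.Relation.Unary.AllPairs using (_∷_)
open import Data.List.Relation.Unary.Unique.Propositional.Properties
  using (++⁺; filter⁺; upTo⁺; applyUpTo⁺₁; Unique[x∷xs]⇒x∉xs)
open import Data.Vec using (Vec; map; lookup)
import Data.Vec as V
import Data.Vec.Properties as VP
import Data.Fin as Fin
open import Relation.Nullary using (yes; no; ¬?)
open import Relation.Binary.PropositionalEquality
open import Function using (_∘_)
open import Function.Bundles using (_⇔_; mk⇔; Equivalence)

_⊑_ : ∀ {Q : Set} → Oracle Q → Oracle Q → Set
τ ⊑ τ′ = ∀ q b → τ q ≡ just b → τ′ q ≡ just b

⊑-from-≗ : ∀ {Q : Set} {τ τ′ : Oracle Q} → (∀ q → τ q ≡ τ′ q) → τ ⊑ τ′
⊑-from-≗ τ≗τ′ q b answer = trans (sym (τ≗τ′ q)) answer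

module _ {Q I O : Set} (Ψ : Machine Q I O) where
  open Machine Ψ

  runs-extend : ∀ {τ τ′ : Oracle Q} → τ ⊑ τ′ → ∀ {s o} → Runs Ψ τ s o → Runs Ψ τ′ s o
  runs-extend τ⊑τ′ (r-halt e)      = r-halt e
  runs-extend τ⊑τ′ (r-query e a r) = r-query e (τ⊑τ′ _ _ a) (runs-extend τ⊑τ′ r)
  runs-extend τ⊑τ′ (r-tau e r)     = r-tau e (runs-extend τ⊑τ′ r)

  runs-deterministic : ∀ {τ : Oracle Q} {s o o′} → Runs Ψ τ s o → Runs Ψ τ s o′ → o ≡ o′
  runs-deterministic (r-halt e) (r-halt e′) with refl ← trans (sym e) e′ = refl
  runs-deterministic (r-query e a r) (r-query e′ a′ r′)
    with refl ← trans (sym e) e′ with refl ← trans (sym a) a′ = runs-deterministic r r′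
  runs-deterministic (r-tau e r) (r-tau e′ r′)
    with refl ← trans (sym e) e′ = runs-deterministic r r′
  runs-deterministic (r-halt e)      (r-query e′ _ _) with () ← trans (sym e) e′
  runs-deterministic (r-halt e)      (r-tau e′ _)     with () ← trans (sym e) e′
  runs-deterministic (r-query e _ _) (r-halt e′)      with () ← trans (sym e) e′
  runs-deterministic (r-query e _ _) (r-tau e′ _)     with () ← trans (sym e) e′
  runs-deterministic (r-tau e _)     (r-halt e′)      with () ← trans (sym e) e′
  runs-deterministic (r-tau e _)     (r-query e′ _ _) with () ← trans (sym e) e′

  -- Use principle: a halting run asks finitely many queries, so for any size
  -- measure on queries it survives replacing the oracle by any oracle that
  -- agrees with it on all queries below some size bound m.
  runs-use : (size : Q → ℕ) {τ : Oracle Q} {s : State} {o : O} → Runs Ψ τ s o →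
             ∃[ m ] (∀ (τ′ : Oracle Q) → (∀ q → size q < m → τ′ q ≡ τ q) → Runs Ψ τ′ s o)
  runs-use size (r-halt e) = 0 , λ _ _ → r-halt e
  runs-use size (r-query {q = q} e a r) with m , survives ← runs-use size r =
    suc (size q) ⊔ m , λ τ′ agree →
      r-query e (trans (agree q (m≤n⇒m≤n⊔o m ≤-refl)) a)
        (survives τ′ (λ q′ q′<m → agree q′ (<-≤-trans q′<m (m≤n⊔m (suc (size q)) m))))
  runs-use size (r-tau e r) with m , survives ← runs-use size r =
    m , λ τ′ agree → r-tau e (survives τ′ agree)

nth-applyUpTo : ∀ (h : ℕ → ℕ) n t → t < n → nth (applyUpTo h n) t ≡ h t
nth-applyUpTo h (suc n) zero    _         = refl
nth-applyUpTo h (suc n) (suc t) (s≤s t<n) = nth-applyUpTo (h ∘ suc) n t t<n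

nth-++ˡ : ∀ xs ys t → t < length xs → nth (xs ++ ys) t ≡ nth xs t
nth-++ˡ (x ∷ xs) ys zero    _          = refl
nth-++ˡ (x ∷ xs) ys (suc t) (s≤s t<xs) = nth-++ˡ xs ys t t<xs

nth-++ʳ : ∀ xs ys t → nth (xs ++ ys) (length xs + t) ≡ nth ys t
nth-++ʳ []       ys t = refl
nth-++ʳ (x ∷ xs) ys t = nth-++ʳ xs ys t

nth-map : ∀ (h : ℕ → ℕ) xs t → t < length xs → nth (L.map h xs) t ≡ h (nth xs t)
nth-map h (x ∷ xs) zero    _          = refl
nth-map h (x ∷ xs) (suc t) (s≤s t<xs) = nth-map h xs t t<xs

nth-∈ : ∀ xs t → t < length xs → nth xs t ∈ xs
nth-∈ (x ∷ xs) zero    _          = here refl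
nth-∈ (x ∷ xs) (suc t) (s≤s t<xs) = there (nth-∈ xs t t<xs)

indexOf-∈ : ∀ xs {x} → x ∈ xs → indexOf xs x < length xs × nth xs (indexOf xs x) ≡ x
indexOf-∈ (y ∷ ys) {x} x∈ with x ≡ᵇ y in x≡ᵇy
... | true = s≤s z≤n , sym (≡ᵇ⇒≡ x y (Equivalence.from T-≡ x≡ᵇy))
indexOf-∈ (y ∷ ys) {x} (here refl) | false = ⊥-elim (subst T x≡ᵇy (≡⇒≡ᵇ x x refl))
indexOf-∈ (y ∷ ys) {x} (there x∈) | false with lt , eq ← indexOf-∈ ys x∈ = s≤s lt , eq

indexOf-nth : ∀ xs t → Unique xs → t < length xs → indexOf xs (nth xs t) ≡ t
indexOf-nth (y ∷ ys) zero    _ _ rewrite Equivalence.to T-≡ (≡⇒≡ᵇ y y refl) = refl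
indexOf-nth (y ∷ ys) (suc t) u@(_ ∷ uys) (s≤s t<ys) with nth ys t ≡ᵇ y in eq
... | true  = ⊥-elim (Unique[x∷xs]⇒x∉xs u
                (subst (_∈ ys) (≡ᵇ⇒≡ _ y (Equivalence.from T-≡ eq)) (nth-∈ ys t t<ys)))
... | false = cong suc (indexOf-nth ys t uys t<ys)

same-members-length : ∀ {xs ys : List ℕ} → Unique xs → Unique ys →
                      (∀ {x} → x ∈ xs → x ∈ ys) → (∀ {x} → x ∈ ys → x ∈ xs) →
                      length xs ≡ length ys
same-members-length uxs uys xs⊆ys ys⊆xs =
  ↭-length (∼bag⇒↭ (unique∧set⇒bag uxs uys (mk⇔ xs⊆ys ys⊆xs)))

-- union b c lists b followed by the members of c not in b
-- (it is  b ++ minus c b  in the construction of Dom).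
union : List ℕ → List ℕ → List ℕ
union b c = b ++ filter (λ x → ¬? (x ∈? b)) c

union-∈⁻ : ∀ {x} b c → x ∈ union b c → x ∈ b ⊎ x ∈ c
union-∈⁻ b c x∈ with ∈-++⁻ b x∈
... | inj₁ x∈b = inj₁ x∈b
... | inj₂ x∈c∖b = inj₂ (proj₁ (∈-filter⁻ (λ x → ¬? (x ∈? b)) x∈c∖b))

union-∈⁺ : ∀ {x} b c → x ∈ b ⊎ x ∈ c → x ∈ union b c
union-∈⁺ b c (inj₁ x∈b) = ∈-++⁺ˡ x∈b
union-∈⁺ {x} b c (inj₂ x∈c) with x ∈? b
... | yes x∈b = ∈-++⁺ˡ x∈b
... | no  x∉b = ∈-++⁺ʳ b (∈-filter⁺ (λ x → ¬? (x ∈? b)) x∈c x∉b)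

union-unique : ∀ b c → Unique b → Unique c → Unique (union b c)
union-unique b c ub uc = ++⁺ ub (filter⁺ (λ x → ¬? (x ∈? b)) uc)
  (λ (x∈b , x∈c∖b) → proj₂ (∈-filter⁻ (λ x → ¬? (x ∈? b)) {xs = c} x∈c∖b) x∈b)

union-comm-⊆ : ∀ {x} b c → x ∈ union b c → x ∈ union c b
union-comm-⊆ b c x∈ with union-∈⁻ b c x∈
... | inj₁ x∈b = union-∈⁺ c b (inj₂ x∈b)
... | inj₂ x∈c = union-∈⁺ c b (inj₁ x∈c)

union-++-comm-⊆ : ∀ {x} b c d → x ∈ union b c ++ d → x ∈ union c b ++ d
union-++-comm-⊆ b c d x∈ with ∈-++⁻ (union b c) x∈
... | inj₁ x∈bc = ∈-++⁺ˡ (union-comm-⊆ b c x∈bc)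
... | inj₂ x∈d  = ∈-++⁺ʳ (union c b) x∈d

union-++-unique : ∀ b c d → Unique b → Unique c → Unique d →
                  (∀ {x} → x ∈ d → x ∈ b ⊎ x ∈ c → ⊥) → Unique (union b c ++ d)
union-++-unique b c d ub uc ud fresh =
  ++⁺ (union-unique b c ub uc) ud (λ (x∈bc , x∈d) → fresh x∈d (union-∈⁻ b c x∈bc))

record Bij : Set where
  field
    fun     : ℕ → ℕ
    inv     : ℕ → ℕ
    inv-fun : ∀ x → inv (fun x) ≡ x
    fun-inv : ∀ y → fun (inv y) ≡ y
open Bij public

idBij : Bij
idBij = record { fun = λ x → x ; inv = λ x → x ; inv-fun = λ _ → refl ; fun-inv = λ _ → refl }

fun-injective : (f : Bij) → ∀ {x y} → fun f x ≡ fun f y → x ≡ y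
fun-injective f {x} {y} fx≡fy = begin
  x               ≡⟨ inv-fun f x ⟨
  inv f (fun f x) ≡⟨ cong (inv f) fx≡fy ⟩
  inv f (fun f y) ≡⟨ inv-fun f y ⟩
  y               ∎
  where open ≡-Reasoning

record Enumerates (f : Bij) (X : List ℕ) : Set where
  constructor enumerates
  field at : ∀ t → t < length X → fun f t ≡ nth X t
open Enumerates public

enumerates-∈ : ∀ f X t → Enumerates f X → t < length X → fun f t ∈ X
enumerates-∈ f X t enum t<X = subst (_∈ X) (sym (at enum t t<X)) (nth-∈ X t t<X)

enumerates-indexOf : ∀ f X {y} → Enumerates f X → y ∈ X → inv f y ≡ indexOf X y
enumerates-indexOf f X {y} enum y∈X with t<X , X[t]≡y ← indexOf-∈ X y∈X =
  trans (cong (inv f) (trans (sym X[t]≡y) (sym (at enum _ t<X)))) (inv-fun f _)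

enumerates-inv : ∀ f X {y} → Enumerates f X → y ∈ X → inv f y < length X
enumerates-inv f X {y} enum y∈X =
  subst (_< length X) (sym (enumerates-indexOf f X enum y∈X)) (proj₁ (indexOf-∈ X y∈X))

enumerates-upTo : ∀ n → Enumerates idBij (upTo n)
enumerates-upTo n = enumerates λ t t<n →
  sym (nth-applyUpTo (λ x → x) n t (subst (t <_) (LP.length-upTo n) t<n))

enumerates-prefix : ∀ f X Z → Enumerates f (X ++ Z) → Enumerates f X
enumerates-prefix f X Z enum = enumerates λ t t<X →
  trans (at enum t (<-≤-trans t<X (subst (length X ≤_) (sym (LP.length-++ X)) (m≤m+n _ _))))
        (nth-++ˡ X Z t t<X)

enumerates-++ : ∀ f P (h : ℕ → ℕ) m → Enumerates f P →
                (∀ t → fun f (length P + t) ≡ h t) → Enumerates f (P ++ applyUpTo h m)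
enumerates-++ f P h m enumP f≡h = enumerates at-P++H
  where
    at-P++H : ∀ t → t < length (P ++ applyUpTo h m) → fun f t ≡ nth (P ++ applyUpTo h m) t
    at-P++H t t<PH with t <? length P
    ... | yes t<P = trans (at enumP t t<P) (sym (nth-++ˡ P _ t t<P))
    ... | no  t≮P = subst (λ u → fun f u ≡ nth (P ++ applyUpTo h m) u) P+t′≡t
          (trans (f≡h t′) (trans (sym (nth-applyUpTo h m t′ t′<m)) (sym (nth-++ʳ P _ t′))))
      where
        t′ = t ∸ length P
        P+t′≡t : length P + t′ ≡ t
        P+t′≡t = m+[n∸m]≡n (≮⇒≥ t≮P)
        t′<m : t′ < m
        t′<m = +-cancelˡ-< (length P) t′ m
          (subst (_< length P + m) (sym P+t′≡t)
            (subst (t <_) (trans (LP.length-++ P) (cong (length P +_) (LP.length-applyUpTo h m)))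
                   t<PH))

-- Re-enumeration: if f enumerates P and Q is a duplicate-free list with the
-- same members, then some bijection g enumerates Q and agrees with f beyond
-- the common length (g is f composed with a permutation of {0,…,|Q|-1}).
module Reenumerate (f : Bij) (P Q : List ℕ) (uP : Unique P) (uQ : Unique Q)
       (P⊆Q : ∀ {x} → x ∈ P → x ∈ Q) (Q⊆P : ∀ {x} → x ∈ Q → x ∈ P)
       (enumP : Enumerates f P) where

  |P|≡|Q| : length P ≡ length Q
  |P|≡|Q| = same-members-length uP uQ P⊆Q Q⊆P

  gfun : ℕ → ℕ
  gfun t with t <? length Q
  ... | yes _ = nth Q t
  ... | no  _ = fun f t

  ginv : ℕ → ℕ
  ginv y with y ∈? Q
  ... | yes _ = indexOf Q y
  ... | no  _ = inv f y

  ginv-gfun : ∀ t → ginv (gfun t) ≡ t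
  ginv-gfun t with t <? length Q
  ... | yes t<Q with nth Q t ∈? Q
  ...   | yes _ = indexOf-nth Q t uQ t<Q
  ...   | no Q[t]∉Q = ⊥-elim (Q[t]∉Q (nth-∈ Q t t<Q))
  ginv-gfun t | no t≮Q with fun f t ∈? Q
  ...   | no  _     = inv-fun f t
  ...   | yes ft∈Q  = ⊥-elim (t≮Q (subst (_< length Q) (inv-fun f t)
                        (subst (_ <_) |P|≡|Q| (enumerates-inv f P enumP (Q⊆P ft∈Q)))))

  gfun-ginv : ∀ y → gfun (ginv y) ≡ y
  gfun-ginv y with y ∈? Q
  ... | yes y∈Q with i<Q , Q[i]≡y ← indexOf-∈ Q y∈Q with indexOf Q y <? length Q
  ...   | yes _   = Q[i]≡y
  ...   | no  i≮Q = ⊥-elim (i≮Q i<Q)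
  gfun-ginv y | no y∉Q with inv f y <? length Q
  ...   | no  _    = fun-inv f y
  ...   | yes i<Q  = ⊥-elim (y∉Q (P⊆Q (subst (_∈ P) (fun-inv f y)
                       (enumerates-∈ f P _ enumP (subst (_ <_) (sym |P|≡|Q|) i<Q)))))

  g : Bij
  g = record { fun = gfun ; inv = ginv ; inv-fun = ginv-gfun ; fun-inv = gfun-ginv }

  enumQ : Enumerates g Q
  enumQ = enumerates at-Q
    where
      at-Q : ∀ t → t < length Q → gfun t ≡ nth Q t
      at-Q t t<Q with t <? length Q
      ... | yes _   = refl
      ... | no  t≮Q = ⊥-elim (t≮Q t<Q)

  agrees-beyond : ∀ t → length Q ≤ t → fun g t ≡ fun f t
  agrees-beyond t Q≤t with t <? length Q
  ... | yes t<Q = ⊥-elim (<⇒≱ t<Q Q≤t)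
  ... | no  _   = refl

-- Every duplicate-free tuple is an initial segment of some bijection:
-- re-enumerate the identity on {0,…,K-1} ⊇ X as X followed by the rest.
enumeration-exists : ∀ X → Unique X → Σ Bij λ f → Enumerates f X
enumeration-exists X uX =
  R.g , enumerates-prefix R.g X _ R.enumQ
  where
    K = suc (L.foldr _⊔_ 0 X)
    bound : ∀ {x} (xs : List ℕ) → x ∈ xs → x < suc (L.foldr _⊔_ 0 xs)
    bound (y ∷ ys) (here refl) = s≤s (m≤m⊔n y _)
    bound (y ∷ ys) (there x∈)  = s≤s (≤-trans (≤-pred (bound ys x∈)) (m≤n⊔m y _))
    Q = union X (upTo K)
    Q⊆upTo : ∀ {x} → x ∈ Q → x ∈ upTo K
    Q⊆upTo x∈ with union-∈⁻ X (upTo K) x∈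
    ... | inj₁ x∈X = ∈-upTo⁺ (bound X x∈X)
    ... | inj₂ x∈K = x∈K
    module R = Reenumerate idBij (upTo K) Q (upTo⁺ K) (union-unique X (upTo K) uX (upTo⁺ K))
                 (λ x∈ → union-∈⁺ X (upTo K) (inj₂ x∈)) Q⊆upTo (enumerates-upTo K)

block : Bij → List ℕ → ℕ → List ℕ
block f P m = applyUpTo (λ t → fun f (length P + t)) m

block-unique : ∀ f P m → Unique (block f P m)
block-unique f P m = applyUpTo⁺₁ _ m
  (λ t<u _ ft≡fu → <⇒≢ t<u (+-cancelˡ-≡ (length P) _ _ (fun-injective f ft≡fu)))

length-block : ∀ f P m X → m ≤ length (X ++ block f P m)
length-block f P m X =
  subst (m ≤_) (sym (trans (LP.length-++ X) (cong (length X +_) (LP.length-applyUpTo _ m))))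
        (m≤n+m m (length X))

block-fresh : ∀ f P m {x} → Enumerates f P → x ∈ block f P m → x ∉ P
block-fresh f P m enumP x∈block x∈P with t , _ , refl ← ∈-applyUpTo⁻ _ x∈block =
  m+n≮m (length P) t (subst (_< length P) (inv-fun f _) (enumerates-inv f P enumP x∈P))

if-true : ∀ {A : Set} {c} {x y : A} → T c → (if c then x else y) ≡ x
if-true {c = true} _ = refl

if-just : ∀ {c x b : Bool} → (if c then just x else nothing) ≡ just b → T c × x ≡ b
if-just {true} refl = _ , refl

vmax : ∀ {n} → Vec ℕ n → ℕ
vmax V.[]       = 0
vmax (x V.∷ xs) = x ⊔ vmax xs

vmax-lookup : ∀ {n} (v : Vec ℕ n) s → lookup v s ≤ vmax v
vmax-lookup (x V.∷ v) Fin.zero    = m≤m⊔n x (vmax v)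
vmax-lookup (x V.∷ v) (Fin.suc s) = ≤-trans (vmax-lookup v s) (m≤n⊔m x (vmax v))

all-below : ∀ {k} (v : Vec ℕ k) n → vmax v < n → T (allᵇ (λ x → x <ᵇ n) v)
all-below V.[]       n _ = _
all-below (x V.∷ v) n v<n = Equivalence.from T-∧
  (<⇒<ᵇ (≤-<-trans (m≤m⊔n x (vmax v)) v<n) , all-below v n (≤-<-trans (m≤n⊔m x (vmax v)) v<n))

map-cong-below : ∀ {k} (v : Vec ℕ k) n {h₁ h₂ : ℕ → ℕ} → T (allᵇ (λ x → x <ᵇ n) v) →
                 (∀ t → t < n → h₁ t ≡ h₂ t) → map h₁ v ≡ map h₂ v
map-cong-below V.[]       n _     _      = refl
map-cong-below (x V.∷ v) n below h₁≡h₂ with x<n , v<n ← Equivalence.to T-∧ below =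
  cong₂ V._∷_ (h₁≡h₂ x (<ᵇ⇒< x n x<n)) (map-cong-below v n v<n h₁≡h₂)

-- A size measure on atomic facts: an atom of size < n mentions only the first
-- n relation symbols and the first n elements.
atomSize : ∀ {ar} → Atom ar → ℕ
atomSize (k , v) = k ⊔ vmax v

module Pullbacks {arA arB : Arity} (A : Str arA) (B : Str arB)
  (Φ : Machine (Atom arB) (Atom arA) Bool) (Φ* : Machine (QB arB) ℕ ℕ)
  (F : IsComputableFunctor A B Φ Φ*) where

  open DomConstruction B Φ Φ*
  open IsComputableFunctor F

  -- B_f: the copy of B in which x names the element f(x).
  Pull : Bij → Str arB
  Pull f k v = B k (map (fun f) v)

  pull-iso : (f : Bij) → Iso (Pull f) B
  pull-iso f = record { fun = fun f ; inv = inv f ; inv-fun = inv-fun f ; fun-inv = fun-inv f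
                      ; pres = λ k v → refl }

  change : (f g : Bij) → Iso (Pull f) (Pull g)
  change f g = record
    { fun     = λ x → inv g (fun f x)
    ; inv     = λ y → inv f (fun g y)
    ; inv-fun = λ x → trans (cong (inv f) (fun-inv g (fun f x))) (inv-fun f x)
    ; fun-inv = λ y → trans (cong (inv g) (fun-inv f (fun g y))) (inv-fun g y)
    ; pres    = λ k v → cong (B k) (sym (trans (sym (VP.map-∘ (fun g) _ v))
                                                (VP.map-cong (λ x → fun-inv g (fun f x)) v)))
    }

  record Transport (f g : Bij) (i j : ℕ) : Set where
    constructor transport
    field run : Conv Φ* (morOracle {arA} (Pull f) (Pull g) (λ x → inv g (fun f x))) i j

  morOracle-cong : ∀ (P₁ P₂ : Str arB) {h h′ : ℕ → ℕ} → (∀ x → h x ≡ h′ x) →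
                   morOracle {arA} P₁ P₂ h ⊑ morOracle {arA} P₁ P₂ h′
  morOracle-cong P₁ P₂ h≗h′ (inj₁ q)               b a = a
  morOracle-cong P₁ P₂ h≗h′ (inj₂ (inj₁ (x , y))) b a rewrite sym (h≗h′ x) = a
  morOracle-cong P₁ P₂ h≗h′ (inj₂ (inj₂ q))        b a = a

  transport-id : ∀ f i → Transport f f i i
  transport-id f i = transport
    (runs-extend Φ* (morOracle-cong (Pull f) (Pull f) (λ x → sym (inv-fun f x)))
      (id-law (Pull f) (pull-iso f) i))

  transport-comp : ∀ {f g h i j k} → Transport f g i j → Transport g h j k → Transport f h i k
  transport-comp {f} {g} {h} {i} {j} {k} (transport fg) (transport gh) = transport
    (runs-extend Φ* (morOracle-cong (Pull f) (Pull h) (λ x → cong (inv h) (fun-inv g (fun f x))))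
      (comp-law (Pull f) (Pull g) (Pull h) (pull-iso f) (pull-iso g) (pull-iso h)
                (change f g) (change g h) i j k fg gh))

  transport-deterministic : ∀ {f g i j j′} → Transport f g i j → Transport f g i j′ → j ≡ j′
  transport-deterministic (transport r) (transport r′) = runs-deterministic Φ* r r′

  transport-total : ∀ f g i → ∃[ j ] Transport f g i j
  transport-total f g i =
    _ , transport (proj₂ (mor (Pull f) (Pull g) (pull-iso f) (pull-iso g) (change f g)) i)

  transport-sym : ∀ {f g i j} → Transport f g i j → Transport g f j i
  transport-sym {f} {g} {i} {j} fg with k , gf ← transport-total g f j
    with refl ← transport-deterministic (transport-comp fg gf) (transport-id f i) = gf

  diagram-transport : ∀ f g k (js v : Vec ℕ (arA k)) →
    (∀ s → Transport f g (lookup js s) (lookup v s)) →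
    Conv Φ (total (D (Pull f))) (k , js) true → Conv Φ (total (D (Pull g))) (k , v) true
  diagram-transport f g k js v js↦v Φf = subst (Conv Φ (total (D (Pull g))) (k , v)) Fg[v] Φg
    where
      H = mor (Pull f) (Pull g) (pull-iso f) (pull-iso g) (change f g)
      h = Iso.fun (proj₁ H)
      Ff = proj₁ (obj (Pull f) (pull-iso f))
      Fg = proj₁ (obj (Pull g) (pull-iso g))
      Φf′ : Conv Φ (total (D (Pull f))) (k , js) (Ff k js)
      Φf′ = proj₂ (proj₂ (obj (Pull f) (pull-iso f))) (k , js)
      Φg : Conv Φ (total (D (Pull g))) (k , v) (Fg k v)
      Φg = proj₂ (proj₂ (obj (Pull g) (pull-iso g))) (k , v)
      h[js]≡v : map h js ≡ v
      h[js]≡v = begin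
        map h js                            ≡⟨ VP.tabulate∘lookup (map h js) ⟨
        V.tabulate (lookup (map h js))      ≡⟨ VP.tabulate-cong (λ s → trans (VP.lookup-map s h js)
            (transport-deterministic (transport (proj₂ H (lookup js s))) (js↦v s))) ⟩
        V.tabulate (lookup v)               ≡⟨ VP.tabulate∘lookup v ⟩
        v                                   ∎
        where open ≡-Reasoning
      Fg[v] : Fg k v ≡ true
      Fg[v] = begin
        Fg k v          ≡⟨ cong (Fg k) h[js]≡v ⟨
        Fg k (map h js) ≡⟨ Iso.pres (proj₁ H) k js ⟨
        Ff k js         ≡⟨ runs-deterministic Φ Φf′ Φf ⟩
        true            ∎
        where open ≡-Reasoning

  -- Finite approximations.  D(X̄) is the part of D(B_f) of size < |X̄| when
  -- f enumerates X̄, and s is a finite part of g⁻¹ ∘ f when Consistent s f g.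

  Dfin-⊑ : ∀ f X → Enumerates f X → Dfin X ⊑ total (D (Pull f))
  Dfin-⊑ f X enum (k , v) b answer with inRange , B[X[v]]≡b ← if-just answer =
    cong just (trans (cong (B k) (map-cong-below v (length X) (proj₂ (Equivalence.to T-∧ inRange))
                                                (at enum)))
                     B[X[v]]≡b)

  Dfin-agrees : ∀ f X → Enumerates f X → ∀ q → atomSize q < length X →
                Dfin X q ≡ total (D (Pull f)) q
  Dfin-agrees f X enum (k , v) small =
    trans (if-true (Equivalence.from T-∧ (<⇒<ᵇ k<X , all-below v (length X) v<X)))
          (cong just (cong (B k) (map-cong-below v (length X) (all-below v (length X) v<X)
                                    (λ t t<X → sym (at enum t t<X)))))
    where
      k<X = ≤-<-trans (m≤m⊔n k (vmax v)) small
      v<X = ≤-<-trans (m≤n⊔m k (vmax v)) small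

  record Consistent (s : List ℕ) (f g : Bij) : Set where
    constructor consistent
    field lists : ∀ t → t < length s → nth s t ≡ inv g (fun f t)
  open Consistent

  -- Size of a query to Φ*: a query of size < m only concerns the first m
  -- elements, relation symbols and arguments of g⁻¹ ∘ f.
  querySize : QB arB → ℕ
  querySize (inj₁ a)              = atomSize a
  querySize (inj₂ (inj₁ (x , _))) = x
  querySize (inj₂ (inj₂ a))       = atomSize a

  finOracle-⊑ : ∀ f g X Y s → Enumerates f X → Enumerates g Y → Consistent s f g →
                finOracle X s Y ⊑ morOracle {arA} (Pull f) (Pull g) (λ x → inv g (fun f x))
  finOracle-⊑ f g X Y s enumX enumY cons (inj₁ q)        = Dfin-⊑ f X enumX q
  finOracle-⊑ f g X Y s enumX enumY cons (inj₂ (inj₂ q)) = Dfin-⊑ g Y enumY q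
  finOracle-⊑ f g X Y s enumX enumY cons (inj₂ (inj₁ (x , y))) b answer
    with x<s , s[x]≡ᵇy≡b ← if-just answer =
    cong just (trans (cong (_≡ᵇ y) (sym (lists cons x (<ᵇ⇒< x _ x<s)))) s[x]≡ᵇy≡b)

  finOracle-agrees : ∀ f g X Y s m → Enumerates f X → Enumerates g Y → Consistent s f g →
    m ≤ length X → m ≤ length Y → m ≤ length s → ∀ q → querySize q < m →
    finOracle X s Y q ≡ morOracle {arA} (Pull f) (Pull g) (λ x → inv g (fun f x)) q
  finOracle-agrees f g X Y s m enumX enumY cons m≤X m≤Y m≤s (inj₁ q) small =
    Dfin-agrees f X enumX q (<-≤-trans small m≤X)
  finOracle-agrees f g X Y s m enumX enumY cons m≤X m≤Y m≤s (inj₂ (inj₂ q)) small =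
    Dfin-agrees g Y enumY q (<-≤-trans small m≤Y)
  finOracle-agrees f g X Y s m enumX enumY cons m≤X m≤Y m≤s (inj₂ (inj₁ (x , y))) small =
    trans (if-true (<⇒<ᵇ x<s)) (cong just (cong (_≡ᵇ y) (lists cons x x<s)))
    where x<s = <-≤-trans small m≤s

  finite→transport : ∀ {f g X Y s i j} → Enumerates f X → Enumerates g Y → Consistent s f g →
                     Conv Φ* (finOracle X s Y) i j → Transport f g i j
  finite→transport {f} {g} {X} {Y} {s} enumX enumY cons c =
    transport (runs-extend Φ* (finOracle-⊑ f g X Y s enumX enumY cons) c)

  Approximable : Bij → Bij → ℕ → ℕ → ℕ → Set
  Approximable f g i j m = ∀ X Y s → Enumerates f X → Enumerates g Y → Consistent s f g →
    m ≤ length X → m ≤ length Y → m ≤ length s → Conv Φ* (finOracle X s Y) i j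

  transport→finite : ∀ {f g i j} → Transport f g i j → ∃[ m ] Approximable f g i j m
  transport→finite {f} {g} (transport r) with m , survives ← runs-use Φ* querySize r =
    m , λ X Y s enumX enumY cons m≤X m≤Y m≤s →
      survives (finOracle X s Y) (finOracle-agrees f g X Y s m enumX enumY cons m≤X m≤Y m≤s)

  Φ-finite→total : ∀ {f X a o} → Enumerates f X → Conv Φ (Dfin X) a o →
                   Conv Φ (total (D (Pull f))) a o
  Φ-finite→total {f} {X} enum = runs-extend Φ (Dfin-⊑ f X enum)

  Φ-total→finite : ∀ {f a o} → Conv Φ (total (D (Pull f))) a o →
                   ∃[ m ] (∀ X → Enumerates f X → m ≤ length X → Conv Φ (Dfin X) a o)
  Φ-total→finite {f} c with m , survives ← runs-use Φ atomSize c =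
    m , λ X enum m≤X → survives (Dfin X) (λ q small → Dfin-agrees f X enum q (<-≤-trans small m≤X))

  B≡Pull-id : ∀ q → total (D B) q ≡ total (D (Pull idBij)) q
  B≡Pull-id (k , v) = cong (λ w → just (B k w)) (sym (VP.map-id v))

  upTo-consistent : ∀ f g X → Enumerates f X → Enumerates g X → Consistent (upTo (length X)) f g
  upTo-consistent f g X enumf enumg = consistent λ t t<X →
    let t<|X| = subst (t <_) (LP.length-upTo (length X)) t<X in begin
    nth (upTo (length X)) t ≡⟨ at (enumerates-upTo (length X)) t t<X ⟨
    t                       ≡⟨ inv-fun g t ⟨
    inv g (fun g t)         ≡⟨ cong (inv g) (trans (at enumg t t<|X|) (sym (at enumf t t<|X|))) ⟩
    inv g (fun f t)         ∎
    where open ≡-Reasoning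

  perm-consistent : ∀ {f g X Y} → Enumerates f X → Enumerates g Y → (∀ {x} → x ∈ X → x ∈ Y) →
                    Consistent (perm X Y) f g
  perm-consistent {f} {g} {X} {Y} enumX enumY X⊆Y = consistent λ t t<perm →
    let t<X = subst (t <_) (LP.length-map (indexOf Y) X) t<perm in begin
    nth (perm X Y) t       ≡⟨ nth-map (indexOf Y) X t t<X ⟩
    indexOf Y (nth X t)    ≡⟨ enumerates-indexOf g Y enumY (X⊆Y (nth-∈ X t t<X)) ⟨
    inv g (nth X t)        ≡⟨ cong (inv g) (at enumX t t<X) ⟨
    inv g (fun f t)        ∎
    where open ≡-Reasoning

  -- (c̄ , j) ∈ Dom says that F fixes j under every change of enumeration of c̄.
  dom-transport : ∀ {c j f g} → InDom (c , j) → Enumerates f c → Enumerates g c → Transport f g j j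
  dom-transport {c} {f = f} {g} (_ , conv) enumf enumg =
    finite→transport enumf enumg (upTo-consistent f g c enumf enumg) conv

  padded-union : ∀ b c d → b ++ minus c b ++ d ≡ union b c ++ d
  padded-union b c d = sym (LP.++-assoc b (minus c b) d)

  padded-comm-⊆ : ∀ b c d {x} → x ∈ b ++ minus c b ++ d → x ∈ c ++ minus b c ++ d
  padded-comm-⊆ b c d x∈ = subst (_ ∈_) (sym (padded-union c b d))
    (union-++-comm-⊆ b c d (subst (_ ∈_) (padded-union b c d) x∈))

  -- Given the witness d̄ of (b̄ , i) ∼ (c̄ , j), enumerate the padded tuples X̄, Ȳ
  -- by fX, fY: the finite computation gives F(fY⁻¹ ∘ fX) : i ↦ j, and since
  -- X̄, Ȳ start with b̄, c̄, dom-transport connects fX to f and fY to g.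
  ∼→transport : ∀ {b i c j f g} → (b , i) ∼ (c , j) → Enumerates f b → Enumerates g c →
                Transport f g i j
  ∼→transport {b} {i} {c} {j} (dB@(ub , _) , dC@(uc , _) , d , ud , fresh , conv , _) enumb enumc =
    transport-comp (transport-comp (dom-transport dB enumb (enumerates-prefix fX b _ enumX)) X↦Y)
                   (dom-transport dC (enumerates-prefix fY c _ enumY) enumc)
    where
      X = b ++ minus c b ++ d
      Y = c ++ minus b c ++ d
      fresh-b∪c : ∀ {x} → x ∈ d → x ∈ b ⊎ x ∈ c → ⊥
      fresh-b∪c x∈d = LAll.lookup fresh x∈d ∘ [ ∈-++⁺ˡ , ∈-++⁺ʳ b ]′
      uX : Unique X
      uX = subst Unique (sym (padded-union b c d)) (union-++-unique b c d ub uc ud fresh-b∪c)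
      uY : Unique Y
      uY = subst Unique (sym (padded-union c b d))
             (union-++-unique c b d uc ub ud (λ x∈d → fresh-b∪c x∈d ∘ swap))
      fX = proj₁ (enumeration-exists X uX)
      enumX = proj₂ (enumeration-exists X uX)
      fY = proj₁ (enumeration-exists Y uY)
      enumY = proj₂ (enumeration-exists Y uY)
      X↦Y : Transport fX fY i j
      X↦Y = finite→transport enumX enumY (perm-consistent enumX enumY (padded-comm-⊆ b c d)) conv

  approximable→conv : ∀ {f g i j m X Y} → Approximable f g i j m →
    Enumerates f X → Enumerates g Y → (∀ {x} → x ∈ X → x ∈ Y) → m ≤ length X → m ≤ length Y →
    Conv Φ* (finOracle X (perm X Y) Y) i j
  approximable→conv {X = X} {Y} approx enumX enumY X⊆Y m≤X m≤Y =
    approx X Y (perm X Y) enumX enumY (perm-consistent enumX enumY X⊆Y) m≤X m≤Y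
           (subst (_ ≤_) (sym (LP.length-map (indexOf Y) X)) m≤X)

  -- Conversely, let f′ enumerate b̄ ∪ c̄ and g′ enumerate c̄ ∪ b̄, continuing
  -- with the same values.  If F(g′⁻¹ ∘ f′) sends i to j, pad both unions by the
  -- same block d̄ of further values, long enough for both directions.
  padding→∼ : ∀ {b i c j f′ g′} → InDom (b , i) → InDom (c , j) →
    Enumerates f′ (union b c) → Enumerates g′ (union c b) →
    (∀ t → fun g′ (length (union c b) + t) ≡ fun f′ (length (union b c) + t)) →
    Transport f′ g′ i j → (b , i) ∼ (c , j)
  padding→∼ {b} {i} {c} {j} {f′} {g′} dB dC enumP enumQ continues f′↦g′ =
    dB , dC , d , block-unique f′ P m , fresh , X↦Y , Y↦X
    where
      P = union b c
      Q = union c b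
      m₁ = proj₁ (transport→finite f′↦g′)
      m₂ = proj₁ (transport→finite (transport-sym f′↦g′))
      m = m₁ + m₂
      d = block f′ P m
      X = b ++ minus c b ++ d
      Y = c ++ minus b c ++ d
      fresh : LAll.All (λ x → x ∉ b ++ c) d
      fresh = LAll.tabulate λ x∈d x∈bc → block-fresh f′ P m enumP x∈d (union-∈⁺ b c (∈-++⁻ b x∈bc))
      enumX : Enumerates f′ X
      enumX = subst (Enumerates f′) (sym (padded-union b c d))
                (enumerates-++ f′ P _ m enumP (λ _ → refl))
      enumY : Enumerates g′ Y
      enumY = subst (Enumerates g′) (sym (padded-union c b d))
                (enumerates-++ g′ Q _ m enumQ continues)
      m≤X : m ≤ length X
      m≤X = subst (m ≤_) (cong length (sym (padded-union b c d))) (length-block f′ P m P)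
      m≤Y : m ≤ length Y
      m≤Y = subst (m ≤_) (cong length (sym (padded-union c b d))) (length-block f′ P m Q)
      X↦Y : Conv Φ* (finOracle X (perm X Y) Y) i j
      X↦Y = approximable→conv (proj₂ (transport→finite f′↦g′)) enumX enumY (padded-comm-⊆ b c d)
              (≤-trans (m≤m+n m₁ m₂) m≤X) (≤-trans (m≤m+n m₁ m₂) m≤Y)
      Y↦X : Conv Φ* (finOracle Y (perm Y X) X) j i
      Y↦X = approximable→conv (proj₂ (transport→finite (transport-sym f′↦g′))) enumY enumX
              (padded-comm-⊆ c b d) (≤-trans (m≤n+m m₂ m₁) m≤Y) (≤-trans (m≤n+m m₂ m₁) m≤X)

  -- Such f′, g′ exist (re-enumerate an enumeration of b̄ ∪ c̄), and F(g′⁻¹ ∘ f′)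
  -- sends i to j because it factors through F(g⁻¹ ∘ f) by dom-transport.
  transport→∼ : ∀ {b i c j f g} → InDom (b , i) → InDom (c , j) →
                Enumerates f b → Enumerates g c → Transport f g i j → (b , i) ∼ (c , j)
  transport→∼ {b} {i} {c} {j} dB@(ub , _) dC@(uc , _) enumb enumc f↦g =
    padding→∼ dB dC enumP R.enumQ continues
      (transport-comp (transport-comp (dom-transport dB (enumerates-prefix fP b _ enumP) enumb) f↦g)
                      (dom-transport dC enumc (enumerates-prefix R.g c _ R.enumQ)))
    where
      P = union b c
      Q = union c b
      uP = union-unique b c ub uc
      fP = proj₁ (enumeration-exists P uP)
      enumP = proj₂ (enumeration-exists P uP)
      module R = Reenumerate fP P Q uP (union-unique c b uc ub)
                   (union-comm-⊆ b c) (union-comm-⊆ c b) enumP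
      continues : ∀ t → fun R.g (length Q + t) ≡ fun fP (length P + t)
      continues t = trans (R.agrees-beyond _ (m≤m+n _ t))
                          (cong (λ n → fun fP (n + t)) (sym R.|P|≡|Q|))

  dom-eventually : ∀ i → ∃[ m ] (∀ M → m ≤ M → InDom (upTo M , i))
  dom-eventually i with m , approx ← transport→finite (transport-id idBij i) =
    m , λ M m≤M → upTo⁺ M ,
      approx (upTo M) (upTo M) (upTo (length (upTo M))) (enumerates-upTo M) (enumerates-upTo M)
             (upTo-consistent idBij idBij (upTo M) (enumerates-upTo M) (enumerates-upTo M))
             (m≤length m≤M) (m≤length m≤M) (m≤length (m≤length m≤M))
    where
      m≤length : ∀ {m M} → m ≤ M → m ≤ length (upTo M)
      m≤length {m} {M} = subst (m ≤_) (sym (LP.length-upTo M))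

  -- The theorem holds for any choice of N with (B↾N i , i) ∈ Dom.
  module Induced (N : ℕ → ℕ) (N-dom : ∀ i → InDom (upTo (N i) , i)) where

    𝔉 : ℕ → List ℕ × ℕ
    𝔉 i = (upTo (N i) , i)

    -- B↾n is enumerated by the identity, so 𝔉 i ∼ 𝔉 j means F(id) : i ↦ j.
    𝔉-injective : ∀ i j → 𝔉 i ∼ 𝔉 j → i ≡ j
    𝔉-injective i j 𝔉i∼𝔉j = transport-deterministic (transport-id idBij i)
      (∼→transport 𝔉i∼𝔉j (enumerates-upTo (N i)) (enumerates-upTo (N j)))

    -- For (c̄ , j) ∈ Dom and an enumeration g of c̄, take i = F(g)(j).
    𝔉-surjective : ∀ x → InDom x → ∃[ i ] (𝔉 i ∼ x)
    𝔉-surjective (c , j) dC@(uc , _) with g , enumc ← enumeration-exists c uc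
      with i , c↦i ← transport-total g idBij j =
      i , transport→∼ (N-dom i) dC (enumerates-upTo (N i)) enumc (transport-sym c↦i)

    -- If Φ^{D(B)} accepts P_k(v̄), a long enough segment B↾M witnesses R_k.
    𝔉-preserves : ∀ k (v : Vec ℕ (arA k)) → Conv Φ (total (D B)) (k , v) true → R k (map 𝔉 v)
    𝔉-preserves k v Φ[v]
      with m₀ , finite ← Φ-total→finite (runs-extend Φ (⊑-from-≗ B≡Pull-id) Φ[v]) =
      upTo M , v , upTo⁺ M , related ,
      finite (upTo M) (enumerates-upTo M) (subst (m₀ ≤_) (sym (LP.length-upTo M)) (m≤m+n m₀ _))
      where
        bound : ℕ → ℕ
        bound x = proj₁ (dom-eventually x)
        M = m₀ + vmax (map bound v)
        related : ∀ s → lookup (map 𝔉 v) s ∼ (upTo M , lookup v s)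
        related s = subst (_∼ (upTo M , x)) (sym (VP.lookup-map s 𝔉 v))
          (transport→∼ (N-dom x) (proj₂ (dom-eventually x) M x-bound)
                       (enumerates-upTo (N x)) (enumerates-upTo M) (transport-id idBij x))
          where
            x = lookup v s
            x-bound : bound x ≤ M
            x-bound = ≤-trans (subst (_≤ vmax (map bound v)) (VP.lookup-map s bound v)
                                     (vmax-lookup (map bound v) s))
                              (m≤n+m _ m₀)

    -- A witness c̄ of R_k transports, via an enumeration g of c̄, to D(F(B)).
    𝔉-reflects : ∀ k (v : Vec ℕ (arA k)) → R k (map 𝔉 v) → Conv Φ (total (D B)) (k , v) true
    𝔉-reflects k v (c , js , uc , related , Φc[js]) with g , enumc ← enumeration-exists c uc =
      runs-extend Φ (⊑-from-≗ (sym ∘ B≡Pull-id))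
        (diagram-transport g idBij k js v g↦id (Φ-finite→total enumc Φc[js]))
      where
        g↦id : ∀ s → Transport g idBij (lookup js s) (lookup v s)
        g↦id s = transport-sym (∼→transport (subst (_∼ _) (VP.lookup-map s 𝔉 v) (related s))
                                            (enumerates-upTo (N (lookup v s))) enumc)

lemma2p10 : {arA arB : Arity} (A : Str arA) (B : Str arB)
  (Φ : Machine (Atom arB) (Atom arA) Bool) (Φ* : Machine (QB arB) ℕ ℕ) →
  IsComputableFunctor A B Φ Φ* →
  let open DomConstruction B Φ Φ* in
  (∀ i → ∃[ n ] InDom (upTo n , i)) ×
  ((N : ℕ → ℕ) → (∀ i → IsLeast i (N i)) →
    let 𝔉 : ℕ → List ℕ × ℕ
        𝔉 i = (upTo (N i) , i)
    in (∀ i j → 𝔉 i ∼ 𝔉 j → i ≡ j) ×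
       (∀ x → InDom x → ∃[ i ] (𝔉 i ∼ x)) ×
       (∀ k (v : Vec ℕ (arA k)) →
          Conv Φ (total (D B)) (k , v) true ⇔ R k (map 𝔉 v)))
lemma2p10 A B Φ Φ* F =
  (λ i → proj₁ (dom-eventually i) , proj₂ (dom-eventually i) _ ≤-refl) ,
  λ N least → let open Induced N (proj₁ ∘ least) in
    𝔉-injective , 𝔉-surjective , λ k v → mk⇔ (𝔉-preserves k v) (𝔉-reflects k v)
  where open Pullbacks A B Φ Φ* F
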